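{- Let $m,r,n$ be positive integers with $n=m^r$ and let $q,s$ be distinct primes. Let $G$ be a permutation group on $\Delta=\{1,\dots,m\}$ such that every element of $G$ having a cycle of size divisible by $q$ and a cycle of size divisible by $s$ also has a cycle of size divisible by $qs$. Let $\iota:G\wr S_r\hookrightarrow S_n$ be the embedding given by the natural action of $G\wr S_r$ on $\Delta^r$. If for some $\pi\in G\wr S_r$ the permutation $\iota(\pi)$ has a cycle of size divisible by $q$ and a cycle of size divisible by $s$, then $\iota(\pi)$ has a cycle of size divisible by $qs$.
   Context: The wreath product $G\wr S_r=G^r\rtimes S_r$ ($S_r$ permuting coordinates) has elements $(\sigma,\tau)$, $\sigma=(\sigma_1,\dots,\sigma_r)\in G^r$, $\tau\in S_r$, acting on $\Delta^r$ by $(\sigma,\tau)(x_1,\dots,x_r)=(\sigma_1(x_{\tau^{ -1}(1)}),\dots,\sigma_r(x_{\tau^{ -1}(r)}))$. -}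

module Defs where

open import Level using (Level; suc; _⊔_)
open import Data.Nat using (ℕ; zero; suc; _<_; _^_)
open import Data.Fin using (Fin; funToFin; finToFun)
open import Data.Fin.Permutation using (Permutation′; _⟨$⟩ʳ_; _⟨$⟩ˡ_; _∘ₚ_; flip; id; _≈_)
open import Data.Product using (Σ; ∃; _×_)
open import Relation.Binary.PropositionalEquality using (_≡_; _≢_)
open import Data.Nat.Divisibility using (_∣_)

iter : {A : Set} → (A → A) → ℕ → A → A
iter f zero    x = x
iter f (suc k) x = f (iter f k x)

CycleSize : {A : Set} → (A → A) → A → ℕ → Set
CycleSize f x k =
  (0 < k) × (iter f k x ≡ x) × (∀ j → 0 < j → j < k → iter f j x ≢ x)

HasCycleDiv : {A : Set} → (A → A) → ℕ → Set
HasCycleDiv {A} f d = Σ A λ x → Σ ℕ λ k → CycleSize f x k × (d ∣ k)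

record PermGroup (m : ℕ) : Set₁ where
  field
    member     : Permutation′ m → Set
    member-resp : ∀ {π ρ} → π ≈ ρ → member π → member ρ
    member-id  : member id
    member-∘   : ∀ {π ρ} → member π → member ρ → member (π ∘ₚ ρ)
    member-inv : ∀ {π} → member π → member (flip π)

-- action of (σ , τ) ∈ G^r ⋊ S_r on Δ^r = (Fin r → Fin m):
-- (σ,τ)(x)_i = σ_i (x_{τ⁻¹(i)})
wreathAct : {m r : ℕ} → (Fin r → Permutation′ m) → Permutation′ r →
            (Fin r → Fin m) → (Fin r → Fin m)
wreathAct σ τ x i = σ i ⟨$⟩ʳ x (τ ⟨$⟩ˡ i)

ι : {m r : ℕ} → (Fin r → Permutation′ m) → Permutation′ r →
    Fin (m ^ r) → Fin (m ^ r)
ι {m} {r} σ τ k = funToFin (wreathAct σ τ (finToFun {m} {r} k))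

{-# OPTIONS --safe #-}
-- Let τ⁻¹ act on the coordinates Fin r, let ℓ j be the length of the τ⁻¹-cycle of j, and let
-- g j ∈ G be the product of the σ's along that cycle. Under ι(σ,τ) the j-th coordinate of a
-- point z after a · ℓ j + n steps is g j ^ a applied to its value after n steps. Hence
-- ∏ ℓ j · c j is a period of z, where c j is the size of the g j-cycle of z j, so a prime
-- dividing the length of an ι-cycle divides some ℓ j or the size of some cycle of some g j.
-- Conversely, each such divisibility can be forced on every period of a suitable z by
-- prescribing the first lap w, v, v, …, v of its j-th coordinate: a constant lap at a point of
-- a g j-cycle of size divisible by p forces p, and a constant lap at a point moved by g j, or
-- a non-constant one (this needs m ≥ 2) when g j = 1, forces ℓ j. The g's along
-- one τ⁻¹-cycle are conjugate, so if q and s arise on the same cycle the hypothesis on G turns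
-- the two requirements into one for q s; on different cycles z is prescribed independently on
-- each. The ι-cycle through z then has length divisible by q and by s, hence by q s.
module Submission where

open import Defs
open import Data.Empty using (⊥; ⊥-elim)
open import Data.Fin as Fin using (Fin; toℕ; funToFin; finToFun)
open import Data.Fin.Permutation using (Permutation′; _⟨$⟩ʳ_; _⟨$⟩ˡ_; _∘ₚ_; id; inverseˡ; inverseʳ)
open import Data.Fin.Properties using (pigeonhole; any?; toℕ-fromℕ<; toℕ<n; finToFun-funToFin; funToFin-finToFin)
open import Data.Nat using (ℕ; zero; suc; _≤_; _<_; _+_; _*_; _∸_; _^_; _%_; _/_; NonZero; _<?_)
open import Data.Nat.Properties
open import Data.Nat.Divisibility using (_∣_; _∣?_; divides; ∣-trans; ∣-antisym; m∣m*n; n∣m*n; m%n≡0⇒n∣m; ∣1⇒≡1)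
open import Data.Nat.DivMod using (m≡m%n+[m/n]*n; m%n<n)
open import Data.Nat.Induction using (<-wellFounded)
open import Data.Nat.Primality using (Prime; euclidsLemma; ¬prime[1]; prime⇒irreducible)
open import Data.Product using (Σ; ∃; ∃₂; _×_; _,_; proj₁; proj₂)
open import Data.Sum using (_⊎_; inj₁; inj₂)
open import Function.Definitions using (Injective)
open import Induction.WellFounded using (Acc; acc)
open import Relation.Nullary using (¬_; Dec; yes; no; ¬?)
open import Relation.Nullary.Decidable using (decidable-stable; _×-dec_)
open import Relation.Binary.PropositionalEquality
open import Relation.Binary.Definitions using (tri<; tri≈; tri>)
open ≡-Reasoning

prime∤1 : ∀ {p} → Prime p → ¬ (p ∣ 1)
prime∤1 pp p∣1 = ¬prime[1] (subst Prime (∣1⇒≡1 p∣1) pp)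

module _ {A : Set} (f : A → A) where

  iter-+ : ∀ a b x → iter f (a + b) x ≡ iter f a (iter f b x)
  iter-+ zero    b x = refl
  iter-+ (suc a) b x = cong f (iter-+ a b x)

  iter-comm : ∀ a b x → iter f a (iter f b x) ≡ iter f b (iter f a x)
  iter-comm a b x = begin
    iter f a (iter f b x) ≡⟨ iter-+ a b x ⟨
    iter f (a + b) x      ≡⟨ cong (λ k → iter f k x) (+-comm a b) ⟩
    iter f (b + a) x      ≡⟨ iter-+ b a x ⟩
    iter f b (iter f a x) ∎

  iter-*-fixed : ∀ {k x} → iter f k x ≡ x → ∀ a → iter f (a * k) x ≡ x
  iter-*-fixed e zero = refl
  iter-*-fixed {k} {x} e (suc a) =
    trans (iter-+ k (a * k) x) (trans (cong (iter f k) (iter-*-fixed e a)) e)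

  iter-fixed : ∀ {x} → f x ≡ x → ∀ a → iter f a x ≡ x
  iter-fixed {x} e a = subst (λ k → iter f k x ≡ x) (*-identityʳ a) (iter-*-fixed e a)

  iter-% : ∀ {k x} .{{_ : NonZero k}} → iter f k x ≡ x → ∀ j → iter f j x ≡ iter f (j % k) x
  iter-% {k} {x} e j = begin
    iter f j x                              ≡⟨ cong (λ u → iter f u x) (m≡m%n+[m/n]*n j k) ⟩
    iter f (j % k + j / k * k) x            ≡⟨ iter-+ (j % k) (j / k * k) x ⟩
    iter f (j % k) (iter f (j / k * k) x)   ≡⟨ cong (iter f (j % k)) (iter-*-fixed e (j / k)) ⟩
    iter f (j % k) x                        ∎

  iter-undo : ∀ {k x} .{{_ : NonZero k}} → iter f k x ≡ x → ∀ n → iter f (n * k ∸ n) (iter f n x) ≡ x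
  iter-undo {k} {x} e n = begin
    iter f (n * k ∸ n) (iter f n x) ≡⟨ iter-+ (n * k ∸ n) n x ⟨
    iter f (n * k ∸ n + n) x        ≡⟨ cong (λ u → iter f u x) (m∸n+n≡m (m≤m*n n k)) ⟩
    iter f (n * k) x                ≡⟨ iter-*-fixed e n ⟩
    x                               ∎

  iter-+∸ : ∀ {a b} x → a ≤ b → iter f a (iter f (b ∸ a) x) ≡ iter f b x
  iter-+∸ {a} {b} x a≤b = trans (sym (iter-+ a (b ∸ a) x)) (cong (λ u → iter f u x) (m+[n∸m]≡n a≤b))

  iter-injective : Injective _≡_ _≡_ f → ∀ n → Injective _≡_ _≡_ (iter f n)
  iter-injective inj zero    e = e
  iter-injective inj (suc n) e = iter-injective inj n (inj e)

iter-conj : ∀ {A B : Set} {f : A → A} {f′ : B → B} {h : B → A} →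
            (∀ b → f (h b) ≡ h (f′ b)) → ∀ n b → iter f n (h b) ≡ h (iter f′ n b)
iter-conj comm zero    b = refl
iter-conj {f = f} {f′} comm (suc n) b = trans (cong f (iter-conj comm n b)) (comm (iter f′ n b))

module _ {A : Set} {f : A → A} where

  CycleSize⇒NonZero : ∀ {x k} → CycleSize f x k → NonZero k
  CycleSize⇒NonZero {k = suc _} _ = _

  cycleSize∣ : ∀ {x k j} → CycleSize f x k → iter f j x ≡ x → k ∣ j
  cycleSize∣ {x} {k} {j} c@(_ , returns , minimal) e =
    m%n≡0⇒n∣m j k (decidable-stable (j % k ≟ 0) j%k≢0⇒⊥)
    where
    instance _ = CycleSize⇒NonZero c
    j%k≢0⇒⊥ : ¬ (j % k ≢ 0)
    j%k≢0⇒⊥ j%k≢0 = minimal (j % k) (n≢0⇒n>0 j%k≢0) (m%n<n j k)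
      (trans (sym (iter-% f returns j)) e)

  cycleSize∣⇒iter≡ : ∀ {x k j} → CycleSize f x k → k ∣ j → iter f j x ≡ x
  cycleSize∣⇒iter≡ (_ , returns , _) (divides a refl) = iter-*-fixed f returns a

  iterates-distinct : Injective _≡_ _≡_ f → ∀ {x k a b} → CycleSize f x k →
                      a < b → b < k → iter f a x ≢ iter f b x
  iterates-distinct inj {x} {k} {a} {b} (_ , _ , minimal) a<b b<k e =
    minimal (b ∸ a) (m<n⇒0<n∸m a<b) (≤-<-trans (m∸n≤m b a) b<k)
      (iter-injective f inj a (trans (iter-+∸ f x (<⇒≤ a<b)) (sym e)))

  iter-injective-below : Injective _≡_ _≡_ f → ∀ {x k a b} → CycleSize f x k →
                         a < k → b < k → iter f a x ≡ iter f b x → a ≡ b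
  iter-injective-below inj {a = a} {b} c a<k b<k e with <-cmp a b
  ... | tri< a<b _ _ = ⊥-elim (iterates-distinct inj c a<b b<k e)
  ... | tri≈ _ a≡b _ = a≡b
  ... | tri> _ _ b<a = ⊥-elim (iterates-distinct inj c b<a a<k (sym e))

  prime-cycle-moves : ∀ {p x c} → Prime p → CycleSize f x c → p ∣ c → f x ≢ x
  prime-cycle-moves pp cyc p∣c fx≡x = prime∤1 pp (∣-trans p∣c (cycleSize∣ cyc fx≡x))

HasCycleDiv-conj : ∀ {A B : Set} {f : A → A} {f′ : B → B} {h : B → A} → Injective _≡_ _≡_ h →
                   (∀ b → f (h b) ≡ h (f′ b)) → ∀ {d} → HasCycleDiv f′ d → HasCycleDiv f d
HasCycleDiv-conj {h = h} inj comm (x , k , (0<k , returns , minimal) , d∣k) =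
  h x , k , (0<k , trans (iter-conj comm k x) (cong h returns) ,
    λ j 0<j j<k e → minimal j 0<j j<k (inj (trans (sym (iter-conj comm j x)) e))) , d∣k

least-witness : ∀ {Q : ℕ → Set} → (∀ n → Dec (Q n)) → ∀ {n} → Q n →
                ∃ λ k → Q k × (∀ j → j < k → ¬ Q j)
least-witness {Q} Q? = go (<-wellFounded _)
  where
  go : ∀ {n} → Acc _<_ n → Q n → ∃ λ k → Q k × (∀ j → j < k → ¬ Q j)
  go {n} (acc below) qn with anyUpTo? Q? n
  ... | yes (j , j<n , qj) = go (below j<n) qj
  ... | no none = n , qn , λ j j<n qj → none (j , j<n , qj)

module _ {n : ℕ} {f : Fin n → Fin n} (inj : Injective _≡_ _≡_ f) (x : Fin n) where

  return-exists : ∃ λ k → 0 < k × iter f k x ≡ x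
  return-exists with pigeonhole (n<1+n n) (λ (i : Fin (suc n)) → iter f (toℕ i) x)
  ... | i , j , i<j , e = toℕ j ∸ toℕ i , m<n⇒0<n∸m i<j ,
    iter-injective f inj (toℕ i) (trans (iter-+∸ f x (<⇒≤ i<j)) (sym e))

  -- Abstract, so that cycle sizes are never unfolded during type checking.
  abstract
    cycleSize-exists : ∃ (CycleSize f x)
    cycleSize-exists with least-witness (λ k → 0 <? k ×-dec iter f k x Fin.≟ x) (proj₂ return-exists)
    ... | k , (0<k , returns) , minimal = k , 0<k , returns , λ j 0<j j<k e → minimal j j<k (0<j , e)

distinct-primes-∣ : ∀ {q s k} → Prime q → Prime s → q ≢ s → q ∣ k → s ∣ k → q * s ∣ k
distinct-primes-∣ {q} {s} pq ps q≢s (divides a refl) s∣aq with euclidsLemma a q ps s∣aq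
... | inj₁ (divides b refl) = divides b (trans (*-assoc b s q) (cong (b *_) (*-comm s q)))
... | inj₂ s∣q with prime⇒irreducible pq s∣q
...   | inj₁ refl = ⊥-elim (¬prime[1] ps)
...   | inj₂ refl = ⊥-elim (q≢s refl)

∏ : ∀ {r} → (Fin r → ℕ) → ℕ
∏ {zero}  f = 1
∏ {suc r} f = f Fin.zero * ∏ (λ i → f (Fin.suc i))

∣∏ : ∀ {r} (f : Fin r → ℕ) j → f j ∣ ∏ f
∣∏ f Fin.zero    = m∣m*n _
∣∏ f (Fin.suc j) = ∣-trans (∣∏ (λ i → f (Fin.suc i)) j) (n∣m*n (f Fin.zero))

prime∣∏ : ∀ {p r} → Prime p → (f : Fin r → ℕ) → p ∣ ∏ f → ∃ λ j → p ∣ f j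
prime∣∏ {r = zero}  pp f p∣1 = ⊥-elim (prime∤1 pp p∣1)
prime∣∏ {r = suc r} pp f p∣∏ with euclidsLemma (f Fin.zero) (∏ (λ i → f (Fin.suc i))) pp p∣∏
... | inj₁ p∣f₀ = Fin.zero , p∣f₀
... | inj₂ p∣∏′ with prime∣∏ pp (λ i → f (Fin.suc i)) p∣∏′
...   | j , p∣fj = Fin.suc j , p∣fj

⟨$⟩ʳ-injective : ∀ {n} (π : Permutation′ n) → Injective _≡_ _≡_ (π ⟨$⟩ʳ_)
⟨$⟩ʳ-injective π {a} {b} e = trans (sym (inverseˡ π)) (trans (cong (π ⟨$⟩ˡ_) e) (inverseˡ π))

⟨$⟩ˡ-injective : ∀ {n} (π : Permutation′ n) → Injective _≡_ _≡_ (π ⟨$⟩ˡ_)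
⟨$⟩ˡ-injective π {a} {b} e = trans (sym (inverseʳ π)) (trans (cong (π ⟨$⟩ʳ_) e) (inverseʳ π))

funToFin-cong : ∀ {r m} {f g : Fin r → Fin m} → (∀ j → f j ≡ g j) → funToFin f ≡ funToFin g
funToFin-cong {zero}  e = refl
funToFin-cong {suc r} e = cong₂ Fin.combine (e Fin.zero) (funToFin-cong (λ j → e (Fin.suc j)))

module Wreath {m r : ℕ} (σ : Fin r → Permutation′ m) (τ : Permutation′ r) where

  τ⁻¹ : Fin r → Fin r
  τ⁻¹ i = τ ⟨$⟩ˡ i

  cocycle : ℕ → Fin r → Permutation′ m
  cocycle zero    i = id
  cocycle (suc n) i = cocycle n (τ⁻¹ i) ∘ₚ σ i

  trace : (Fin r → Fin m) → Fin r → ℕ → Fin m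
  trace z j n = iter (wreathAct σ τ) n z j

  trace≡cocycle : ∀ z j n → trace z j n ≡ cocycle n j ⟨$⟩ʳ z (iter τ⁻¹ n j)
  trace≡cocycle z j zero    = refl
  trace≡cocycle z j (suc n) = cong (σ j ⟨$⟩ʳ_) (trans (trace≡cocycle z (τ⁻¹ j) n)
    (cong (λ i → cocycle n (τ⁻¹ j) ⟨$⟩ʳ z i) (iter-comm τ⁻¹ n 1 j)))

  trace-cong : ∀ {z z′} j → (∀ n → z (iter τ⁻¹ n j) ≡ z′ (iter τ⁻¹ n j)) →
               ∀ n → trace z j n ≡ trace z′ j n
  trace-cong {z} {z′} j e n = begin
    trace z j n                          ≡⟨ trace≡cocycle z j n ⟩
    cocycle n j ⟨$⟩ʳ z (iter τ⁻¹ n j)    ≡⟨ cong (cocycle n j ⟨$⟩ʳ_) (e n) ⟩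
    cocycle n j ⟨$⟩ʳ z′ (iter τ⁻¹ n j)   ≡⟨ trace≡cocycle z′ j n ⟨
    trace z′ j n                         ∎

  trace-shift : ∀ z j a b → trace z j (a + b) ≡ trace (iter (wreathAct σ τ) b z) j a
  trace-shift z j a b = cong (λ y → y j) (iter-+ (wreathAct σ τ) a b z)

  trace-+ : ∀ z j a b → trace z j (a + b) ≡ cocycle a j ⟨$⟩ʳ trace z (iter τ⁻¹ a j) b
  trace-+ z j a b = trans (trace-shift z j a b) (trace≡cocycle _ j a)

  IsPeriod : (Fin r → Fin m) → ℕ → Set
  IsPeriod z p = ∀ j → trace z j p ≡ z j

  DividesPeriods : ℕ → (Fin r → Fin m) → Set
  DividesPeriods d z = ∀ p → IsPeriod z p → d ∣ p

  trace-periodic : ∀ {z p} → IsPeriod z p → ∀ j n → trace z j (n + p) ≡ trace z j n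
  trace-periodic {z} {p} per j n = begin
    trace z j (n + p)                          ≡⟨ trace-+ z j n p ⟩
    cocycle n j ⟨$⟩ʳ trace z (iter τ⁻¹ n j) p  ≡⟨ cong (cocycle n j ⟨$⟩ʳ_) (per _) ⟩
    cocycle n j ⟨$⟩ʳ z (iter τ⁻¹ n j)          ≡⟨ trace≡cocycle z j n ⟨
    trace z j n                                ∎

  trace-*period : ∀ {z p} → IsPeriod z p → ∀ j a → trace z j (a * p) ≡ z j
  trace-*period per j zero = refl
  trace-*period {z} {p} per j (suc a) = begin
    trace z j (p + a * p) ≡⟨ cong (trace z j) (+-comm p (a * p)) ⟩
    trace z j (a * p + p) ≡⟨ trace-periodic per j (a * p) ⟩
    trace z j (a * p)     ≡⟨ trace-*period per j a ⟩
    z j                   ∎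

  IsPeriod-cong : ∀ {z z′ p} → (∀ j → z j ≡ z′ j) → IsPeriod z′ p → IsPeriod z p
  IsPeriod-cong {p = p} e per j =
    trans (trace-cong j (λ n → e (iter τ⁻¹ n _)) p) (trans (per j) (sym (e j)))

  τ⁻¹-injective : Injective _≡_ _≡_ τ⁻¹
  τ⁻¹-injective = ⟨$⟩ˡ-injective τ

  ℓ : Fin r → ℕ
  ℓ j = proj₁ (cycleSize-exists τ⁻¹-injective j)

  ℓ-cycleSize : ∀ j → CycleSize τ⁻¹ j (ℓ j)
  ℓ-cycleSize j = proj₂ (cycleSize-exists τ⁻¹-injective j)

  ℓ-returns : ∀ j → iter τ⁻¹ (ℓ j) j ≡ j
  ℓ-returns j = proj₁ (proj₂ (ℓ-cycleSize j))

  instance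
    ℓ-nonZero : ∀ {j} → NonZero (ℓ j)
    ℓ-nonZero {j} = CycleSize⇒NonZero (ℓ-cycleSize j)

  ℓ-iter : ∀ e j → ℓ (iter τ⁻¹ e j) ≡ ℓ j
  ℓ-iter e j = ∣-antisym
    (cycleSize∣ (ℓ-cycleSize _) (trans (iter-comm τ⁻¹ (ℓ j) e j) (cong (iter τ⁻¹ e) (ℓ-returns j))))
    (cycleSize∣ (ℓ-cycleSize j) (iter-injective τ⁻¹ τ⁻¹-injective e
      (trans (iter-comm τ⁻¹ e (ℓ (iter τ⁻¹ e j)) j) (ℓ-returns _))))

  g : Fin r → Permutation′ m
  g j = cocycle (ℓ j) j

  trace-ℓ+ : ∀ z j n → trace z j (ℓ j + n) ≡ g j ⟨$⟩ʳ trace z j n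
  trace-ℓ+ z j n = trans (trace-+ z j (ℓ j) n) (cong (λ i → g j ⟨$⟩ʳ trace z i n) (ℓ-returns j))

  trace-*ℓ : ∀ z j a → trace z j (a * ℓ j) ≡ iter (g j ⟨$⟩ʳ_) a (z j)
  trace-*ℓ z j zero    = refl
  trace-*ℓ z j (suc a) = trans (trace-ℓ+ z j (a * ℓ j)) (cong (g j ⟨$⟩ʳ_) (trace-*ℓ z j a))

  cycleSize∣period : ∀ {z p j c} → IsPeriod z p → CycleSize (g j ⟨$⟩ʳ_) (z j) c → c ∣ p
  cycleSize∣period {z} {p} {j} per cyc = cycleSize∣ cyc (begin
    iter (g j ⟨$⟩ʳ_) p (z j) ≡⟨ trace-*ℓ z j p ⟨
    trace z j (p * ℓ j)      ≡⟨ cong (trace z j) (*-comm p (ℓ j)) ⟩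
    trace z j (ℓ j * p)      ≡⟨ trace-*period per j (ℓ j) ⟩
    z j                      ∎)

  cycleSizeAt : (Fin r → Fin m) → Fin r → ℕ
  cycleSizeAt z j = proj₁ (cycleSize-exists (⟨$⟩ʳ-injective (g j)) (z j))

  cycleSizeAt-cycleSize : ∀ z j → CycleSize (g j ⟨$⟩ʳ_) (z j) (cycleSizeAt z j)
  cycleSizeAt-cycleSize z j = proj₂ (cycleSize-exists (⟨$⟩ʳ-injective (g j)) (z j))

  period-bound : ∀ z → IsPeriod z (∏ λ j → ℓ j * cycleSizeAt z j)
  period-bound z j = returns (∣∏ (λ j → ℓ j * cycleSizeAt z j) j)
    where
    c : ℕ
    c = cycleSizeAt z j
    returns : ∀ {N} → ℓ j * c ∣ N → trace z j N ≡ z j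
    returns (divides b refl) = begin
      trace z j (b * (ℓ j * c))      ≡⟨ cong (λ k → trace z j (b * k)) (*-comm (ℓ j) c) ⟩
      trace z j (b * (c * ℓ j))      ≡⟨ cong (trace z j) (*-assoc b c (ℓ j)) ⟨
      trace z j (b * c * ℓ j)        ≡⟨ trace-*ℓ z j (b * c) ⟩
      iter (g j ⟨$⟩ʳ_) (b * c) (z j) ≡⟨ cycleSize∣⇒iter≡ (cycleSizeAt-cycleSize z j) (n∣m*n b) ⟩
      z j                            ∎

  HasTrace : (Fin r → Fin m) → Fin r → Fin m → Fin m → Set
  HasTrace z j w v = z j ≡ w × (∀ n → 0 < n → n < ℓ j → trace z j n ≡ v)

  misaligned-period : ∀ {z p j w v} → IsPeriod z p → HasTrace z j w v → ¬ ℓ j ∣ p →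
                      ∃ λ a → iter (g j ⟨$⟩ʳ_) a v ≡ w × iter (g j ⟨$⟩ʳ_) (suc a) w ≡ v
  misaligned-period {z} {p} {j} {w} {v} per (z≡w , traceᵥ) ¬ℓ∣p = a , backwards , forwards
    where
    L t a u : ℕ
    L = ℓ j
    t = p % L
    a = p / L
    u = L ∸ t
    0<t : 0 < t
    0<t = n≢0⇒n>0 (λ t≡0 → ¬ℓ∣p (m%n≡0⇒n∣m p L t≡0))
    t<L : t < L
    t<L = m%n<n p L
    p≡ : p ≡ t + a * L
    p≡ = m≡m%n+[m/n]*n p L
    backwards : iter (g j ⟨$⟩ʳ_) a v ≡ w
    backwards = begin
      iter (g j ⟨$⟩ʳ_) a v                       ≡⟨ cong (iter (g j ⟨$⟩ʳ_) a) (traceᵥ t 0<t t<L) ⟨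
      iter (g j ⟨$⟩ʳ_) a (trace z j t)           ≡⟨ trace-*ℓ (iter (wreathAct σ τ) t z) j a ⟨
      trace (iter (wreathAct σ τ) t z) j (a * L) ≡⟨ trace-shift z j (a * L) t ⟨
      trace z j (a * L + t)                      ≡⟨ cong (trace z j) (trans (+-comm (a * L) t) (sym p≡)) ⟩
      trace z j p                                ≡⟨ per j ⟩
      z j                                        ≡⟨ z≡w ⟩
      w                                          ∎
    forwards : iter (g j ⟨$⟩ʳ_) (suc a) w ≡ v
    forwards = begin
      iter (g j ⟨$⟩ʳ_) (suc a) w          ≡⟨ cong (iter (g j ⟨$⟩ʳ_) (suc a)) z≡w ⟨
      iter (g j ⟨$⟩ʳ_) (suc a) (z j)      ≡⟨ trace-*ℓ z j (suc a) ⟨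
      trace z j (L + a * L)               ≡⟨ cong (λ k → trace z j (k + a * L)) (m∸n+n≡m (<⇒≤ t<L)) ⟨
      trace z j (u + t + a * L)           ≡⟨ cong (trace z j) (+-assoc u t (a * L)) ⟩
      trace z j (u + (t + a * L))         ≡⟨ cong (λ k → trace z j (u + k)) p≡ ⟨
      trace z j (u + p)                   ≡⟨ trace-periodic per j u ⟩
      trace z j u                         ≡⟨ traceᵥ u (m<n⇒0<n∸m t<L) (∸-monoʳ-< 0<t (<⇒≤ t<L)) ⟩
      v                                   ∎

  ℓ∣period-moving : ∀ {z p j w} → IsPeriod z p → HasTrace z j w w → g j ⟨$⟩ʳ w ≢ w → ℓ j ∣ p
  ℓ∣period-moving {p = p} {j} {w} per tr moves =
    decidable-stable (ℓ j ∣? p) (λ ¬ℓ∣p → absurd (misaligned-period per tr ¬ℓ∣p))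
    where
    absurd : (∃ λ a → iter (g j ⟨$⟩ʳ_) a w ≡ w × iter (g j ⟨$⟩ʳ_) (suc a) w ≡ w) → ⊥
    absurd (a , backwards , forwards) = moves (trans (cong (g j ⟨$⟩ʳ_) (sym backwards)) forwards)

  ℓ∣period-fixed : ∀ {z p j w v} → IsPeriod z p → HasTrace z j w v → v ≢ w →
                   g j ⟨$⟩ʳ w ≡ w → ℓ j ∣ p
  ℓ∣period-fixed {p = p} {j} {w} {v} per tr v≢w fixed =
    decidable-stable (ℓ j ∣? p) (λ ¬ℓ∣p → absurd (misaligned-period per tr ¬ℓ∣p))
    where
    absurd : (∃ λ a → iter (g j ⟨$⟩ʳ_) a v ≡ w × iter (g j ⟨$⟩ʳ_) (suc a) w ≡ v) → ⊥
    absurd (a , _ , forwards) = v≢w (trans (sym forwards) (iter-fixed (g j ⟨$⟩ʳ_) fixed (suc a)))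

  InOrbit : Fin r → Fin r → Set
  InOrbit i j = Σ (Fin (ℓ i)) λ k → iter τ⁻¹ (toℕ k) i ≡ j

  inOrbit? : ∀ i j → Dec (InOrbit i j)
  inOrbit? i j = any? (λ k → iter τ⁻¹ (toℕ k) i Fin.≟ j)

  inOrbit-iter : ∀ i e → InOrbit i (iter τ⁻¹ e i)
  inOrbit-iter i e = Fin.fromℕ< (m%n<n e (ℓ i)) ,
    trans (cong (λ u → iter τ⁻¹ u i) (toℕ-fromℕ< (m%n<n e (ℓ i)))) (sym (iter-% τ⁻¹ (ℓ-returns i) e))

  ¬InOrbit-iter : ∀ {i j} → ¬ InOrbit i j → ∀ n → ¬ InOrbit i (iter τ⁻¹ n j)
  ¬InOrbit-iter {i} {j} ¬ij n (k , e) = ¬ij (subst (InOrbit i) back (inOrbit-iter i (n * ℓ j ∸ n + toℕ k)))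
    where
    back : iter τ⁻¹ (n * ℓ j ∸ n + toℕ k) i ≡ j
    back = trans (iter-+ τ⁻¹ (n * ℓ j ∸ n) (toℕ k) i)
      (trans (cong (iter τ⁻¹ (n * ℓ j ∸ n)) e) (iter-undo τ⁻¹ (ℓ-returns j) n))

  firstThen : Fin m → Fin m → ℕ → Fin m
  firstThen w v zero    = w
  firstThen w v (suc _) = v

  module _ (i : Fin r) (w v : Fin m) (z₀ : Fin r → Fin m) where

    plantAt : ∀ j → Dec (InOrbit i j) → Fin m
    plantAt j (yes (k , _)) = cocycle (toℕ k) i ⟨$⟩ˡ firstThen w v (toℕ k)
    plantAt j (no _)        = z₀ j

    plant : Fin r → Fin m
    plant j = plantAt j (inOrbit? i j)

    plantAt-orbit : ∀ {n} → n < ℓ i → (d : Dec (InOrbit i (iter τ⁻¹ n i))) →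
                    plantAt (iter τ⁻¹ n i) d ≡ cocycle n i ⟨$⟩ˡ firstThen w v n
    plantAt-orbit n<ℓ (yes (k , e))
      with refl ← iter-injective-below τ⁻¹-injective (ℓ-cycleSize i) (toℕ<n k) n<ℓ e = refl
    plantAt-orbit {n} n<ℓ (no ¬in) = ⊥-elim (¬in (inOrbit-iter i n))

    plantAt-outside : ∀ {j} → ¬ InOrbit i j → (d : Dec (InOrbit i j)) → plantAt j d ≡ z₀ j
    plantAt-outside ¬in (yes in′) = ⊥-elim (¬in in′)
    plantAt-outside ¬in (no _)    = refl

    trace-plant : ∀ n → n < ℓ i → trace plant i n ≡ firstThen w v n
    trace-plant n n<ℓ = trans (trace≡cocycle plant i n)
      (trans (cong (cocycle n i ⟨$⟩ʳ_) (plantAt-orbit n<ℓ (inOrbit? i (iter τ⁻¹ n i)))) (inverseʳ (cocycle n i)))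

    plant-HasTrace : HasTrace plant i w v
    plant-HasTrace = trace-plant 0 (proj₁ (ℓ-cycleSize i)) , λ where
      (suc n) _ n<ℓ → trace-plant (suc n) n<ℓ

    HasTrace-plant : ∀ {i′ w′ v′} → ¬ InOrbit i i′ → HasTrace z₀ i′ w′ v′ → HasTrace plant i′ w′ v′
    HasTrace-plant {i′} ¬in (z₀≡w′ , traceᵥ) =
      trans (outside i′ ¬in) z₀≡w′ ,
      λ n 0<n n<ℓ → trans (trace-cong i′ (λ k → outside _ (¬InOrbit-iter ¬in k)) n) (traceᵥ n 0<n n<ℓ)
      where
      outside : ∀ j → ¬ InOrbit i j → plant j ≡ z₀ j
      outside j ¬in = plantAt-outside ¬in (inOrbit? i j)

  g-conj : ∀ i t a → g i ⟨$⟩ʳ (cocycle t i ⟨$⟩ʳ a) ≡ cocycle t i ⟨$⟩ʳ (g (iter τ⁻¹ t i) ⟨$⟩ʳ a)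
  g-conj i t a = begin
    g i ⟨$⟩ʳ (cocycle t i ⟨$⟩ʳ a)          ≡⟨ cong (g i ⟨$⟩ʳ_) (trace≡cocycle const i t) ⟨
    g i ⟨$⟩ʳ trace const i t               ≡⟨ trace-ℓ+ const i t ⟨
    trace const i (ℓ i + t)                ≡⟨ cong (trace const i) (+-comm (ℓ i) t) ⟩
    trace const i (t + ℓ i)                ≡⟨ trace-+ const i t (ℓ i) ⟩
    cocycle t i ⟨$⟩ʳ trace const i′ (ℓ i)  ≡⟨ cong (λ L → cocycle t i ⟨$⟩ʳ trace const i′ L) (ℓ-iter t i) ⟨
    cocycle t i ⟨$⟩ʳ trace const i′ (ℓ i′) ≡⟨ cong (cocycle t i ⟨$⟩ʳ_) (trace≡cocycle const i′ (ℓ i′)) ⟩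
    cocycle t i ⟨$⟩ʳ (g i′ ⟨$⟩ʳ a)         ∎
    where
    const : Fin r → Fin m
    const _ = a
    i′ : Fin r
    i′ = iter τ⁻¹ t i

  Contributes : ℕ → Fin r → Set
  Contributes p j = p ∣ ℓ j ⊎ HasCycleDiv (g j ⟨$⟩ʳ_) p

  Contributes-orbit : ∀ {p i} t → Contributes p (iter τ⁻¹ t i) → Contributes p i
  Contributes-orbit {i = i} t (inj₁ p∣ℓ) = inj₁ (subst (_ ∣_) (ℓ-iter t i) p∣ℓ)
  Contributes-orbit {i = i} t (inj₂ cyc) =
    inj₂ (HasCycleDiv-conj (⟨$⟩ʳ-injective (cocycle t i)) (g-conj i t) cyc)

  Forces : Fin r → Fin m → Fin m → ℕ → Set
  Forces j w v d = ∀ z → HasTrace z j w v → DividesPeriods d z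

  Forces-∣ : ∀ {j w v d d′} → d ∣ d′ → Forces j w v d′ → Forces j w v d
  Forces-∣ d∣d′ F z tr p per = ∣-trans d∣d′ (F z tr p per)

  Forces-realisable : ∀ {j w v d d′} → Forces j w v d → Forces j w v d′ →
                      ∃ λ z → DividesPeriods d z × DividesPeriods d′ z
  Forces-realisable {j} {w} {v} F F′ = z , F z tr , F′ z tr
    where
    z : Fin r → Fin m
    z = plant j w v (λ _ → w)
    tr : HasTrace z j w v
    tr = plant-HasTrace j w v (λ _ → w)

  module _ {e₀ e₁ : Fin m} (e₀≢e₁ : e₀ ≢ e₁) where

    ℓ-forcing-trace : ∀ j → ∃₂ λ w v → Forces j w v (ℓ j)
    ℓ-forcing-trace j with any? (λ w → ¬? (g j ⟨$⟩ʳ w Fin.≟ w))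
    ... | yes (w , moves) = w , w , λ z tr p per → ℓ∣period-moving per tr moves
    ... | no none = e₀ , e₁ , λ z tr p per → ℓ∣period-fixed per tr (λ e → e₀≢e₁ (sym e)) fixed
      where
      fixed : g j ⟨$⟩ʳ e₀ ≡ e₀
      fixed = decidable-stable (g j ⟨$⟩ʳ e₀ Fin.≟ e₀) (λ moves → none (e₀ , moves))

    forcing-trace : ∀ {p j} → Prime p → Contributes p j →
                    ∃₂ λ w v → Forces j w v p × Forces j w v (ℓ j)
    forcing-trace {j = j} pp (inj₁ p∣ℓ) with ℓ-forcing-trace j
    ... | w , v , Fℓ = w , v , Forces-∣ p∣ℓ Fℓ , Fℓ
    forcing-trace {p} {j} pp (inj₂ (u , c , cyc , p∣c)) = u , u , Fp , Fℓ
      where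
      Fp : Forces j u u p
      Fp z (z≡u , _) k per =
        ∣-trans p∣c (cycleSize∣period per (subst (λ x → CycleSize (g j ⟨$⟩ʳ_) x c) (sym z≡u) cyc))
      Fℓ : Forces j u u (ℓ j)
      Fℓ z tr k per = ℓ∣period-moving per tr (prime-cycle-moves pp cyc p∣c)

  decode : Fin (m ^ r) → Fin r → Fin m
  decode = finToFun

  ι-iter : ∀ n x j → decode (iter (ι σ τ) n x) j ≡ trace (decode x) j n
  ι-iter zero    x j = refl
  ι-iter (suc n) x j =
    trans (finToFun-funToFin (wreathAct σ τ (decode (iter (ι σ τ) n x))) j)
          (cong (σ j ⟨$⟩ʳ_) (ι-iter n x (τ⁻¹ j)))

  ι-iter≡⇒IsPeriod : ∀ {x p} → iter (ι σ τ) p x ≡ x → IsPeriod (decode x) p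
  ι-iter≡⇒IsPeriod {x} {p} e j = trans (sym (ι-iter p x j)) (cong (λ y → decode y j) e)

  IsPeriod⇒ι-iter≡ : ∀ {x p} → IsPeriod (decode x) p → iter (ι σ τ) p x ≡ x
  IsPeriod⇒ι-iter≡ {x} {p} per = begin
    iter (ι σ τ) p x                      ≡⟨ funToFin-finToFin {r} {m} _ ⟨
    funToFin (decode (iter (ι σ τ) p x))  ≡⟨ funToFin-cong (λ j → trans (ι-iter p x j) (per j)) ⟩
    funToFin (decode x)                   ≡⟨ funToFin-finToFin {r} {m} x ⟩
    x                                     ∎

  ι-injective : Injective _≡_ _≡_ (ι σ τ)
  ι-injective {x} {y} e = begin
    x                   ≡⟨ funToFin-finToFin {r} {m} x ⟨
    funToFin (decode x) ≡⟨ funToFin-cong (λ j → subst (λ k → decode x k ≡ decode y k) (inverseˡ τ)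
                                                            (agree (τ ⟨$⟩ʳ j))) ⟩
    funToFin (decode y) ≡⟨ funToFin-finToFin {r} {m} y ⟩
    y                   ∎
    where
    agree : ∀ j → decode x (τ⁻¹ j) ≡ decode y (τ⁻¹ j)
    agree j = ⟨$⟩ʳ-injective (σ j)
      (trans (sym (ι-iter 1 x j)) (trans (cong (λ z → decode z j) e) (ι-iter 1 y j)))

  Contributes-of-ι-cycle : ∀ {p} → Prime p → HasCycleDiv (ι σ τ) p → ∃ (Contributes p)
  Contributes-of-ι-cycle {p} pp (x , k , cyc , p∣k) = contributes (prime∣∏ pp (λ j → ℓ j * c j) p∣N)
    where
    c : Fin r → ℕ
    c = cycleSizeAt (decode x)
    N : ℕ
    N = ∏ (λ j → ℓ j * c j)
    p∣N : p ∣ N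
    p∣N = ∣-trans p∣k (cycleSize∣ cyc (IsPeriod⇒ι-iter≡ {x} {N} (period-bound (decode x))))
    contributes : (∃ λ j → p ∣ ℓ j * c j) → ∃ (Contributes p)
    contributes (j , p∣ℓc) with euclidsLemma (ℓ j) (c j) pp p∣ℓc
    ... | inj₁ p∣ℓ = j , inj₁ p∣ℓ
    ... | inj₂ p∣c = j , inj₂ (decode x j , c j , cycleSizeAt-cycleSize (decode x) j , p∣c)

  ι-cycle-of-periods : ∀ {d z} → DividesPeriods d z → HasCycleDiv (ι σ τ) d
  ι-cycle-of-periods {d} {z} d∣periods with cycleSize-exists ι-injective (funToFin z)
  ... | k , cyc@(_ , returns , _) =
    funToFin z , k , cyc , d∣periods k
      (IsPeriod-cong {p = k} (λ j → sym (finToFun-funToFin z j)) (ι-iter≡⇒IsPeriod {funToFin z} {k} returns))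

  no-prime-cycle : (∀ (a b : Fin m) → a ≡ b) → ∀ {p} → Prime p → ¬ HasCycleDiv (ι σ τ) p
  no-prime-cycle trivial pp (x , k , cyc , p∣k) =
    prime∤1 pp (∣-trans p∣k (cycleSize∣ cyc (IsPeriod⇒ι-iter≡ {x} {1} (λ j → trivial _ _))))

  module _ (G : PermGroup m) (σ∈G : ∀ i → PermGroup.member G (σ i)) where
    open PermGroup G using (member; member-id; member-∘)

    cocycle∈G : ∀ n i → member (cocycle n i)
    cocycle∈G zero    i = member-id
    cocycle∈G (suc n) i = member-∘ (cocycle∈G n (τ⁻¹ i)) (σ∈G i)

    module _ {e₀ e₁ : Fin m} (e₀≢e₁ : e₀ ≢ e₁) {q s : ℕ} (pq : Prime q) (ps : Prime s) (q≢s : q ≢ s)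
             (hyp : ∀ h → member h → HasCycleDiv (h ⟨$⟩ʳ_) q → HasCycleDiv (h ⟨$⟩ʳ_) s →
                    HasCycleDiv (h ⟨$⟩ʳ_) (q * s)) where

      same-orbit : ∀ {i} → Contributes q i → Contributes s i →
                   ∃ λ z → DividesPeriods q z × DividesPeriods s z
      same-orbit (inj₁ q∣ℓ) cs with forcing-trace e₀≢e₁ ps cs
      ... | _ , _ , Fs , Fℓ = Forces-realisable (Forces-∣ q∣ℓ Fℓ) Fs
      same-orbit cq@(inj₂ _) (inj₁ s∣ℓ) with forcing-trace e₀≢e₁ pq cq
      ... | _ , _ , Fq , Fℓ = Forces-realisable Fq (Forces-∣ s∣ℓ Fℓ)
      same-orbit {i} (inj₂ cq) (inj₂ cs) with hyp (g i) (cocycle∈G (ℓ i) i) cq cs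
      ... | u , c , cyc , qs∣c = (λ _ → u) , at (m∣m*n s) , at (n∣m*n q)
        where
        at : ∀ {d} → d ∣ q * s → DividesPeriods d (λ _ → u)
        at d∣qs p per = ∣-trans (∣-trans d∣qs qs∣c) (cycleSize∣period per cyc)

      distinct-orbits : ∀ {i i′} → ¬ InOrbit i i′ → Contributes q i → Contributes s i′ →
                        ∃ λ z → DividesPeriods q z × DividesPeriods s z
      distinct-orbits {i} {i′} ¬in cq cs with forcing-trace e₀≢e₁ pq cq | forcing-trace e₀≢e₁ ps cs
      ... | w , v , Fq , _ | w′ , v′ , Fs , _ =
        plant i w v z₀ , Fq _ (plant-HasTrace i w v z₀) ,
        Fs _ (HasTrace-plant i w v z₀ ¬in (plant-HasTrace i′ w′ v′ _))
        where
        z₀ : Fin r → Fin m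
        z₀ = plant i′ w′ v′ (λ _ → w′)

      DividesPeriods-* : ∀ {z} → DividesPeriods q z → DividesPeriods s z → DividesPeriods (q * s) z
      DividesPeriods-* q∣ s∣ p per = distinct-primes-∣ pq ps q≢s (q∣ p per) (s∣ p per)

      qs-periods : ∀ {i i′} → Contributes q i → Contributes s i′ → ∃ (DividesPeriods (q * s))
      qs-periods {i} {i′} cq cs with inOrbit? i i′
      ... | yes (k , e)
        with z , q∣ , s∣ ← same-orbit cq (Contributes-orbit (toℕ k) (subst (Contributes s) (sym e) cs))
        = z , DividesPeriods-* q∣ s∣
      ... | no ¬in with z , q∣ , s∣ ← distinct-orbits ¬in cq cs
        = z , DividesPeriods-* q∣ s∣

      ι-qs-cycle : HasCycleDiv (ι σ τ) q → HasCycleDiv (ι σ τ) s → HasCycleDiv (ι σ τ) (q * s)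
      ι-qs-cycle q-cycle s-cycle = ι-cycle-of-periods (proj₂ (qs-periods
        (proj₂ (Contributes-of-ι-cycle pq q-cycle)) (proj₂ (Contributes-of-ι-cycle ps s-cycle))))

Fin1-trivial : ∀ (a b : Fin 1) → a ≡ b
Fin1-trivial Fin.zero Fin.zero = refl

corollary4p11 : (m r n : ℕ) → 0 < m → 0 < r → n ≡ m ^ r →
    (q s : ℕ) → Prime q → Prime s → q ≢ s →
    (G : PermGroup m) →
    (∀ g → PermGroup.member G g →
      HasCycleDiv (g ⟨$⟩ʳ_) q → HasCycleDiv (g ⟨$⟩ʳ_) s →
      HasCycleDiv (g ⟨$⟩ʳ_) (q * s)) →
    (σ : Fin r → Permutation′ m) → (∀ i → PermGroup.member G (σ i)) →
    (τ : Permutation′ r) →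
    HasCycleDiv (ι σ τ) q → HasCycleDiv (ι σ τ) s →
    HasCycleDiv (ι σ τ) (q * s)
-- For m ≤ 1 the map ι is the identity.
corollary4p11 zero          _ _ _ _ _ _ _ pq _ _ _ _ σ _ τ q-cycle _ =
  ⊥-elim (Wreath.no-prime-cycle σ τ (λ ()) pq q-cycle)
corollary4p11 (suc zero)    _ _ _ _ _ _ _ pq _ _ _ _ σ _ τ q-cycle _ =
  ⊥-elim (Wreath.no-prime-cycle σ τ Fin1-trivial pq q-cycle)
corollary4p11 (suc (suc _)) _ _ _ _ _ _ _ pq ps q≢s G hyp σ σ∈G τ =
  Wreath.ι-qs-cycle σ τ G σ∈G {Fin.zero} {Fin.suc Fin.zero} (λ ()) pq ps q≢s hyp
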